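{- Let $D_0$ be a diagram with at most one cell in each column. Then $\mathcal{P}(D_0)$ is ranked, with a rank function given by $rk(D)=rowsum(D)-b(D_0)$ for $D\in KD(D_0)$ (equivalently, $rk(D)$ is the number of empty positions lying below cells of $D$ in their columns).
   Context: A diagram is a finite set $D$ of cells $(r,c)$ with $r,c$ positive integers; $r$ is the row (rows numbered from bottom to top starting at 1) and $c$ the column (numbered from left to right starting at 1). A Kohnert move at row $r$ applied to a diagram $D$: if row $r$ of $D$ is empty, $D$ is unchanged; otherwise let $(r,c)$ be the cell of row $r$ with the largest column index; if every position $(r',c)$ with $1\le r'<r$ belongs to $D$, then $D$ is unchanged; otherwise let $r'$ be the largest integer with $1\le r'<r$ and $(r',c)\notin D$, and the move replaces the cell $(r,c)$ by $(r',c)$. For a diagram $D_0$, $KD(D_0)$ is the set of all diagrams obtainable from $D_0$ by finite (possibly empty) sequences of Kohnert moves. The Kohnert poset $\mathcal{P}(D_0)$ is $KD(D_0)$ ordered by $D_2\preceq D_1$ iff $D_2$ can be obtained from $D_1$ by a finite sequence of Kohnert moves; $Min(D_0)$ is its set of minimal elements. For a diagram $D$, $rowsum(D)=\sum_{(r,c)\in D} r$, and $b(D_0)=\min\{rowsum(T): T\in Min(D_0)\}$. A finite poset $P$ is ranked if there is a function $\rho:P\to\mathbb{Z}_{\ge0}$ such that $x\prec y$ implies $\rho(x)<\rho(y)$ and $\rho(y)=\rho(x)+1$ whenever $y$ covers $x$. -}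

module Defs where

open import Data.Nat using (ℕ; zero; suc; _+_; _∸_; _≤_; _<_; _⊔_; _≡ᵇ_)
open import Data.Bool using (Bool; true; false; if_then_else_; _∧_; not)
open import Data.Product using (_×_; _,_; proj₁; proj₂; Σ; ∃)
open import Data.Maybe using (Maybe; just; nothing)
open import Data.List using (List; []; _∷_; map; filterᵇ; deduplicateᵇ)
open import Data.Bool.ListAction using (any)
open import Data.Nat.ListAction using (sum)
open import Data.List.Membership.Propositional using (_∈_)
open import Relation.Binary.PropositionalEquality using (_≡_)
open import Relation.Nullary using (¬_)
open import Function.Bundles using (_⇔_)

-- A cell (r , c): r = row (bottom to top, from 1), c = column (from 1).
Cell : Set
Cell = ℕ × ℕ

-- A diagram is a finite set of cells, represented by a list of cells
-- (read as a set: order and repetitions are irrelevant; diagrams are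
-- compared by set equality _≐_ below).
Diagram : Set
Diagram = List Cell

_≐_ : Diagram → Diagram → Set
D ≐ E = ∀ (x : Cell) → (x ∈ D) ⇔ (x ∈ E)

PositiveCells : Diagram → Set
PositiveCells D = ∀ (r c : ℕ) → (r , c) ∈ D → (1 ≤ r × 1 ≤ c)

eqCell : Cell → Cell → Bool
eqCell (r , c) (r' , c') = (r ≡ᵇ r') ∧ (c ≡ᵇ c')

memᵇ : Cell → Diagram → Bool
memᵇ x D = any (eqCell x) D

rowsum : Diagram → ℕ
rowsum D = sum (map proj₁ (deduplicateᵇ eqCell D))

rowCols : ℕ → Diagram → List ℕ
rowCols r D = map proj₂ (filterᵇ (λ x → proj₁ x ≡ᵇ r) D)

maxList : List ℕ → Maybe ℕ
maxList [] = nothing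
maxList (c ∷ cs) with maxList cs
... | nothing = just c
... | just m  = just (c ⊔ m)

findGap : ℕ → ℕ → Diagram → Maybe ℕ
findGap zero c D = nothing
findGap (suc k) c D = if memᵇ (suc k , c) D then findGap k c D else just (suc k)

kohnertMove : ℕ → Diagram → Diagram
kohnertMove r D with maxList (rowCols r D)
... | nothing = D
... | just c with findGap (r ∸ 1) c D
...   | nothing = D
...   | just r' = (r' , c) ∷ filterᵇ (λ x → not (eqCell x (r , c))) D

data Reach : Diagram → Diagram → Set where
  reach-refl : ∀ {D} → Reach D D
  reach-step : ∀ {D E} (r : ℕ) → Reach D E → Reach D (kohnertMove r E)

_≼_ : Diagram → Diagram → Set
E ≼ D = Σ Diagram (λ E' → Reach D E' × (E' ≐ E))

_≺_ : Diagram → Diagram → Set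
E ≺ D = (E ≼ D) × ¬ (E ≐ D)

InKD : Diagram → Diagram → Set
InKD D0 D = D ≼ D0

Covers : Diagram → Diagram → Diagram → Set
Covers D0 D1 D2 = (D2 ≺ D1) × (∀ E → InKD D0 E → D2 ≺ E → E ≺ D1 → Data.Empty.⊥)
  where import Data.Empty

IsMin : Diagram → Diagram → Set
IsMin D0 T = InKD D0 T × (∀ T' → InKD D0 T' → T' ≼ T → T' ≐ T)

IsB : Diagram → ℕ → Set
IsB D0 b = Σ Diagram (λ T → IsMin D0 T × rowsum T ≡ b)
         × (∀ T → IsMin D0 T → b ≤ rowsum T)

AtMostOnePerColumn : Diagram → Set
AtMostOnePerColumn D = ∀ (r r' c : ℕ) → (r , c) ∈ D → (r' , c) ∈ D → r ≡ r'

{-# OPTIONS --safe #-}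

-- With at most one cell per column, the position directly below the rightmost cell of a
-- row r ≥ 2 is empty, so every non-trivial Kohnert move lowers one cell by exactly one row.
-- It keeps at most one cell per column, keeps the number of cells, and lowers rowsum by
-- exactly one.  Hence rowsum is at least the number of cells b, with equality for the
-- reachable diagram having all cells in row 1, which is therefore minimal.
-- Rowsum strictly decreases along the order, and since a sequence of moves passes through
-- every intermediate rowsum, a covering relation lowers rowsum by exactly one.
module Submission where

open import Defs
open import Data.Bool using (true; false; not; T)
open import Data.Bool.Properties using (T-∧; T-≡)
open import Data.Empty using (⊥; ⊥-elim)
open import Data.List using ([]; _∷_; map; filter; filterᵇ; deduplicate; deduplicateᵇ)
open import Data.List.Membership.Propositional using (_∈_; _∉_)
open import Data.List.Membership.Propositional.Properties
  using (∈-filter⁻; ∈-filter⁺; ∈-map⁻; ∈-map⁺; deduplicate-∈⇔)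
open import Data.List.Membership.Propositional.Properties.WithK using (unique∧set⇒bag)
open import Data.List.Properties using (filter-≐; filter-all)
open import Data.List.Relation.Binary.BagAndSetEquality using (∼bag⇒↭)
open import Data.List.Relation.Binary.Permutation.Propositional.Properties using (map⁺)
open import Data.List.Relation.Binary.Subset.Propositional using (_⊆_)
open import Data.List.Relation.Unary.All as All using (All; []; _∷_)
open import Data.List.Relation.Unary.Any as Any using (here; there)
open import Data.List.Relation.Unary.Any.Properties using (any⁺; any⁻)
open import Data.List.Relation.Unary.Unique.DecPropositional.Properties using (deduplicate-!)
open import Data.Maybe using (just; nothing)
open import Data.Nat using (ℕ; zero; suc; _+_; _∸_; _≤_; _<_; _≡ᵇ_; z≤n; s≤s)
open import Data.Nat.ListAction using (sum)
open import Data.Nat.ListAction.Properties using (sum-↭)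
open import Data.Nat.Properties
  using (≡ᵇ⇒≡; ≡⇒≡ᵇ; _≟_; ≤-refl; ≤-trans; ≤-antisym; ≤-reflexive; <-trans; ≤∧≢⇒<; n≤1+n;
         <-irrefl; <⇒≤; ≤⇒≯; m≤n⇒m<n∨m≡n; ∸-monoˡ-<; +-∸-assoc; ⊔-sel; m≤m⊔n; m≤n⊔m; +-mono-≤; 1+n≢n;
         module ≤-Reasoning)
open import Data.Product using (_×_; _,_; proj₁; proj₂; Σ)
open import Data.Sum using (_⊎_; inj₁; inj₂)
open import Data.Unit using (tt)
open import Function using (_∘_; const)
open import Function.Bundles using (_⇔_; mk⇔; Equivalence)
open import Function.Construct.Composition using (_⇔-∘_)
open import Function.Construct.Symmetry using (⇔-sym)
open import Relation.Binary.Definitions using (DecidableEquality)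
open import Relation.Binary.PropositionalEquality using (_≡_; _≢_; refl; sym; trans; cong; cong₂; subst; module ≡-Reasoning)
open import Relation.Nullary using (¬_; yes; no)
open import Relation.Nullary.Decidable using (map′; T?; ¬?)

open Equivalence using (to; from)

T-not⇔¬T : ∀ b → T (not b) ⇔ (¬ T b)
T-not⇔¬T false = mk⇔ (λ _ ()) (λ _ → tt)
T-not⇔¬T true  = mk⇔ (λ ()) (λ ¬t → ¬t tt)

T-injective : ∀ {a b} → (T a ⇔ T b) → a ≡ b
T-injective {false} {false} _ = refl
T-injective {false} {true}  e = ⊥-elim (from e tt)
T-injective {true}  {false} e = ⊥-elim (to e tt)
T-injective {true}  {true}  _ = refl

eqCell⇔≡ : ∀ x y → T (eqCell x y) ⇔ x ≡ y
eqCell⇔≡ (r , c) (r′ , c′) = mk⇔ sound complete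
  where
  sound : T (eqCell (r , c) (r′ , c′)) → (r , c) ≡ (r′ , c′)
  sound t = let (r≡ , c≡) = to T-∧ t in cong₂ _,_ (≡ᵇ⇒≡ r r′ r≡) (≡ᵇ⇒≡ c c′ c≡)
  complete : (r , c) ≡ (r′ , c′) → T (eqCell (r , c) (r′ , c′))
  complete refl = from T-∧ (≡⇒≡ᵇ r r refl , ≡⇒≡ᵇ c c refl)

_≟ᶜ_ : DecidableEquality Cell
x ≟ᶜ y = map′ (to (eqCell⇔≡ x y)) (from (eqCell⇔≡ x y)) (T? (eqCell x y))

memᵇ⇔∈ : ∀ x D → T (memᵇ x D) ⇔ x ∈ D
memᵇ⇔∈ x D = mk⇔ (Any.map (λ {y} → to (eqCell⇔≡ x y)) ∘ any⁻ (eqCell x) D)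
                  (any⁺ (eqCell x) ∘ Any.map (λ {y} → from (eqCell⇔≡ x y)))

∈-rowCols : ∀ r c D → c ∈ rowCols r D ⇔ (r , c) ∈ D
∈-rowCols r c D = mk⇔ sound complete
  where
  onRow? = λ (x : Cell) → T? (proj₁ x ≡ᵇ r)
  sound : c ∈ rowCols r D → (r , c) ∈ D
  sound c∈ with ∈-map⁻ proj₂ c∈
  ... | (r′ , c) , x∈ , refl with ∈-filter⁻ onRow? {xs = D} x∈
  ...   | x∈D , onRow rewrite ≡ᵇ⇒≡ r′ r onRow = x∈D
  complete : (r , c) ∈ D → c ∈ rowCols r D
  complete x∈D = ∈-map⁺ proj₂ (∈-filter⁺ onRow? x∈D (≡⇒≡ᵇ r r refl))

_∖_ : Diagram → Cell → Diagram
D ∖ y = filterᵇ (λ x → not (eqCell x y)) D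

∈-∖ : ∀ {x y D} → x ∈ D ∖ y ⇔ (x ∈ D × x ≢ y)
∈-∖ {x} {y} {D} = mk⇔ sound complete
  where
  keep? = λ (z : Cell) → T? (not (eqCell z y))
  sound : x ∈ D ∖ y → x ∈ D × x ≢ y
  sound x∈ = let (x∈D , kept) = ∈-filter⁻ keep? {xs = D} x∈ in
    x∈D , to (T-not⇔¬T (eqCell x y)) kept ∘ from (eqCell⇔≡ x y)
  complete : x ∈ D × x ≢ y → x ∈ D ∖ y
  complete (x∈D , x≢y) = ∈-filter⁺ keep? x∈D (from (T-not⇔¬T (eqCell x y)) (x≢y ∘ to (eqCell⇔≡ x y)))

≐-refl : ∀ {D} → D ≐ D
≐-refl x = mk⇔ (λ p → p) (λ p → p)

≐-sym : ∀ {D E} → D ≐ E → E ≐ D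
≐-sym D≐E x = ⇔-sym (D≐E x)

≐-trans : ∀ {D E F} → D ≐ E → E ≐ F → D ≐ F
≐-trans D≐E E≐F x = E≐F x ⇔-∘ D≐E x

∷-≐ : ∀ y {D E} → D ≐ E → (y ∷ D) ≐ (y ∷ E)
∷-≐ y D≐E x = mk⇔ (λ { (here p) → here p ; (there p) → there (to (D≐E x) p) })
                  (λ { (here p) → here p ; (there p) → there (from (D≐E x) p) })

∖-≐ : ∀ y {D E} → D ≐ E → (D ∖ y) ≐ (E ∖ y)
∖-≐ y D≐E x = ⇔-sym ∈-∖ ⇔-∘ (mk⇔ (λ (p , x≢y) → to (D≐E x) p , x≢y)
                                   (λ (p , x≢y) → from (D≐E x) p , x≢y) ⇔-∘ ∈-∖)

∈⇒≐∷∖ : ∀ {y D} → y ∈ D → D ≐ (y ∷ D ∖ y)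
∈⇒≐∷∖ {y} {D} y∈D x = mk⇔ split join
  where
  split : x ∈ D → x ∈ y ∷ D ∖ y
  split x∈D with x ≟ᶜ y
  ... | yes x≡y = here x≡y
  ... | no x≢y  = there (from ∈-∖ (x∈D , x≢y))
  join : x ∈ y ∷ D ∖ y → x ∈ D
  join (here refl) = y∈D
  join (there p)   = proj₁ (to ∈-∖ p)

cellSum : (Cell → ℕ) → Diagram → ℕ
cellSum f D = sum (map f (deduplicateᵇ eqCell D))

size : Diagram → ℕ
size = cellSum (const 1)

-- The library's membership and uniqueness lemmas for deduplicate need a DecidableEquality.
deduplicateᵇ-eqCell : ∀ D → deduplicateᵇ eqCell D ≡ deduplicate _≟ᶜ_ D
deduplicateᵇ-eqCell []      = refl
deduplicateᵇ-eqCell (x ∷ D) = cong (x ∷_) (begin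
  filter (¬? ∘ T? ∘ eqCell x) (deduplicateᵇ eqCell D)
    ≡⟨ filter-≐ (¬? ∘ T? ∘ eqCell x) (¬? ∘ (x ≟ᶜ_)) (sameTests , sameTests⁻¹) (deduplicateᵇ eqCell D) ⟩
  filter (¬? ∘ (x ≟ᶜ_)) (deduplicateᵇ eqCell D)
    ≡⟨ cong (filter (¬? ∘ (x ≟ᶜ_))) (deduplicateᵇ-eqCell D) ⟩
  filter (¬? ∘ (x ≟ᶜ_)) (deduplicate _≟ᶜ_ D) ∎)
  where
  open ≡-Reasoning
  sameTests : ∀ {y} → ¬ T (eqCell x y) → x ≢ y
  sameTests ¬t = ¬t ∘ from (eqCell⇔≡ x _)
  sameTests⁻¹ : ∀ {y} → x ≢ y → ¬ T (eqCell x y)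
  sameTests⁻¹ x≢y = x≢y ∘ to (eqCell⇔≡ x _)

cellSum-deduplicate : ∀ f D → cellSum f D ≡ sum (map f (deduplicate _≟ᶜ_ D))
cellSum-deduplicate f D = cong (sum ∘ map f) (deduplicateᵇ-eqCell D)

∈-deduplicate : ∀ {x D} → x ∈ D ⇔ x ∈ deduplicate _≟ᶜ_ D
∈-deduplicate = deduplicate-∈⇔ _≟ᶜ_

cellSum-≐ : ∀ f {D E} → D ≐ E → cellSum f D ≡ cellSum f E
cellSum-≐ f {D} {E} D≐E = begin
  cellSum f D                             ≡⟨ cellSum-deduplicate f D ⟩
  sum (map f (deduplicate _≟ᶜ_ D))        ≡⟨ sum-↭ (map⁺ f (∼bag⇒↭ sameBag)) ⟩
  sum (map f (deduplicate _≟ᶜ_ E))        ≡⟨ sym (cellSum-deduplicate f E) ⟩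
  cellSum f E                             ∎
  where
  open ≡-Reasoning
  sameBag = unique∧set⇒bag (deduplicate-! _≟ᶜ_ D) (deduplicate-! _≟ᶜ_ E)
                           (λ {x} → ∈-deduplicate ⇔-∘ (D≐E x ⇔-∘ ⇔-sym ∈-deduplicate))

sum-map-mono : ∀ {A : Set} {f g : A → ℕ} {xs} → All (λ x → f x ≤ g x) xs → sum (map f xs) ≤ sum (map g xs)
sum-map-mono []       = z≤n
sum-map-mono (p ∷ ps) = +-mono-≤ p (sum-map-mono ps)

cellSum-mono : ∀ {f g} D → (∀ {x} → x ∈ D → f x ≤ g x) → cellSum f D ≤ cellSum g D
cellSum-mono {f} {g} D f≤g rewrite cellSum-deduplicate f D | cellSum-deduplicate g D =
  sum-map-mono (All.tabulate (f≤g ∘ from ∈-deduplicate))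

cellSum-∷ : ∀ f {x D} → x ∉ D → cellSum f (x ∷ D) ≡ f x + cellSum f D
cellSum-∷ f {x} {D} x∉D = begin
  cellSum f (x ∷ D)                                              ≡⟨ cellSum-deduplicate f (x ∷ D) ⟩
  f x + sum (map f (filter (¬? ∘ (x ≟ᶜ_)) (deduplicate _≟ᶜ_ D))) ≡⟨ cong (λ xs → f x + sum (map f xs)) (filter-all _ others≢x) ⟩
  f x + sum (map f (deduplicate _≟ᶜ_ D))                         ≡⟨ cong (f x +_) (sym (cellSum-deduplicate f D)) ⟩
  f x + cellSum f D                                              ∎
  where
  open ≡-Reasoning
  others≢x : All (x ≢_) (deduplicate _≟ᶜ_ D)
  others≢x = All.tabulate λ { y∈ refl → x∉D (from ∈-deduplicate y∈) }

maxList-∈ : ∀ {xs m} → maxList xs ≡ just m → m ∈ xs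
maxList-∈ {c ∷ cs} e with maxList cs in max≡
maxList-∈ {c ∷ cs} refl | nothing = here refl
maxList-∈ {c ∷ cs} refl | just m with ⊔-sel c m
... | inj₁ c⊔m≡c = here c⊔m≡c
... | inj₂ c⊔m≡m = there (subst (_∈ cs) (sym c⊔m≡m) (maxList-∈ max≡))

maxList-nothing : ∀ {xs y} → maxList xs ≡ nothing → y ∉ xs
maxList-nothing {x ∷ xs} e _ with maxList xs
maxList-nothing {x ∷ xs} () _ | nothing
maxList-nothing {x ∷ xs} () _ | just _

maxList-≥ : ∀ {xs m y} → maxList xs ≡ just m → y ∈ xs → y ≤ m
maxList-≥ {c ∷ cs} e y∈ with maxList cs in max≡
maxList-≥ {c ∷ cs} refl (here refl) | nothing = ≤-refl
maxList-≥ {c ∷ cs} refl (there y∈)  | nothing = ⊥-elim (maxList-nothing max≡ y∈)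
maxList-≥ {c ∷ cs} refl (here refl) | just m  = m≤m⊔n c m
maxList-≥ {c ∷ cs} refl (there y∈)  | just m  = ≤-trans (maxList-≥ max≡ y∈) (m≤n⊔m c m)

maxList-cong : ∀ {xs ys} → xs ⊆ ys → ys ⊆ xs → maxList xs ≡ maxList ys
maxList-cong {xs} {ys} xs⊆ys ys⊆xs with maxList xs in maxx | maxList ys in maxy
... | nothing | nothing = refl
... | nothing | just n  = ⊥-elim (maxList-nothing maxx (ys⊆xs (maxList-∈ maxy)))
... | just m  | nothing = ⊥-elim (maxList-nothing maxy (xs⊆ys (maxList-∈ maxx)))
... | just m  | just n  = cong just (≤-antisym (maxList-≥ maxy (xs⊆ys (maxList-∈ maxx)))
                                               (maxList-≥ maxx (ys⊆xs (maxList-∈ maxy))))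

maxList-rowCols-≐ : ∀ r {D E} → D ≐ E → maxList (rowCols r D) ≡ maxList (rowCols r E)
maxList-rowCols-≐ r {D} {E} D≐E = maxList-cong
  (from (∈-rowCols r _ E) ∘ to (D≐E _) ∘ to (∈-rowCols r _ D))
  (from (∈-rowCols r _ D) ∘ from (D≐E _) ∘ to (∈-rowCols r _ E))

maxList-rowCols-∈ : ∀ {r c D} → maxList (rowCols r D) ≡ just c → (r , c) ∈ D
maxList-rowCols-∈ {r} {c} {D} = to (∈-rowCols r c D) ∘ maxList-∈

memᵇ-≐ : ∀ x {D E} → D ≐ E → memᵇ x D ≡ memᵇ x E
memᵇ-≐ x {D} {E} D≐E = T-injective (⇔-sym (memᵇ⇔∈ x E) ⇔-∘ (D≐E x ⇔-∘ memᵇ⇔∈ x D))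

findGap-≐ : ∀ k c {D E} → D ≐ E → findGap k c D ≡ findGap k c E
findGap-≐ zero    c D≐E = refl
findGap-≐ (suc k) c D≐E rewrite memᵇ-≐ (suc k , c) D≐E | findGap-≐ k c D≐E = refl

kohnertMove-≐ : ∀ r {D E} → D ≐ E → kohnertMove r D ≐ kohnertMove r E
kohnertMove-≐ r {D} {E} D≐E rewrite maxList-rowCols-≐ r D≐E with maxList (rowCols r E)
... | nothing = D≐E
... | just c rewrite findGap-≐ (r ∸ 1) c D≐E with findGap (r ∸ 1) c E
...   | nothing = D≐E
...   | just r′ = ∷-≐ (r′ , c) (∖-≐ (r , c) D≐E)

Admissible : Diagram → Set
Admissible D = PositiveCells D × AtMostOnePerColumn D

Admissible-≐ : ∀ {D E} → D ≐ E → Admissible D → Admissible E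
Admissible-≐ D≐E (pos , opc) =
  (λ r c p → pos r c (from (D≐E _) p)) , (λ r r′ c p q → opc r r′ c (from (D≐E _) p) (from (D≐E _) q))

lowerCell : ℕ → ℕ → Diagram → Diagram
lowerCell k c D = (suc k , c) ∷ D ∖ (suc (suc k) , c)

record OneRowDown (D E : Diagram) : Set where
  field
    admissible : Admissible E
    rowsum-suc : rowsum D ≡ suc (rowsum E)
    size-≡     : size E ≡ size D

lowerCell-oneRowDown : ∀ {k c D} → Admissible D → (suc (suc k) , c) ∈ D → OneRowDown D (lowerCell k c D)
lowerCell-oneRowDown {k} {c} {D} (pos , opc) cell∈D = record
  { admissible = pos′ , opc′
  ; rowsum-suc = begin
      rowsum D                    ≡⟨ cellSum-D proj₁ ⟩
      suc (suc k + rowsum rest)   ≡⟨ cong suc (sym (cellSum-∷ proj₁ below∉rest)) ⟩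
      suc (rowsum (below ∷ rest)) ∎
  ; size-≡ = trans (cellSum-∷ (const 1) below∉rest) (sym (cellSum-D (const 1)))
  }
  where
  open ≡-Reasoning
  cell below : Cell
  cell  = suc (suc k) , c
  below = suc k , c
  rest = D ∖ cell
  cellSum-D : ∀ f → cellSum f D ≡ f cell + cellSum f rest
  cellSum-D f = trans (cellSum-≐ f (∈⇒≐∷∖ cell∈D)) (cellSum-∷ f (λ p → proj₂ (to (∈-∖ {D = D}) p) refl))
  other-rows : ∀ {r} → (r , c) ∈ D → r ≡ suc (suc k)
  other-rows p = opc _ _ _ p cell∈D
  below∉rest : below ∉ rest
  below∉rest p = 1+n≢n (sym (other-rows (proj₁ (to ∈-∖ p))))
  pos′ : PositiveCells (below ∷ rest)
  pos′ _ _ (here refl) = s≤s z≤n , proj₂ (pos _ _ cell∈D)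
  pos′ r c′ (there p)  = pos r c′ (proj₁ (to ∈-∖ p))
  opc′ : AtMostOnePerColumn (below ∷ rest)
  opc′ _ _ _ (here refl) (here refl) = refl
  opc′ _ _ _ (here refl) (there q) = let (q∈D , q≢cell) = to ∈-∖ q in
    ⊥-elim (q≢cell (cong (_, c) (other-rows q∈D)))
  opc′ _ _ _ (there p) (here refl) = let (p∈D , p≢cell) = to ∈-∖ p in
    ⊥-elim (p≢cell (cong (_, c) (other-rows p∈D)))
  opc′ r r′ c′ (there p) (there q) = opc r r′ c′ (proj₁ (to ∈-∖ p)) (proj₁ (to ∈-∖ q))

findGap-below : ∀ {k c D} → AtMostOnePerColumn D → (suc (suc k) , c) ∈ D → findGap (suc k) c D ≡ just (suc k)
findGap-below {k} {c} {D} opc cell∈D with memᵇ (suc k , c) D in mem≡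
... | false = refl
... | true  = ⊥-elim (1+n≢n (sym (opc _ _ _ (to (memᵇ⇔∈ _ D) (from T-≡ mem≡)) cell∈D)))

-- Only the rightmost cell of a row moves, and by admissibility it lands just below.
kohnertMove-cases : ∀ r {D} → Admissible D → kohnertMove r D ≡ D ⊎ OneRowDown D (kohnertMove r D)
kohnertMove-cases r {D} ad with maxList (rowCols r D) in max≡
... | nothing = inj₁ refl
... | just c with findGap (r ∸ 1) c D in gap≡
...   | nothing = inj₁ refl
kohnertMove-cases zero          ad | just c | just r′ with () ← gap≡
kohnertMove-cases (suc zero)    ad | just c | just r′ with () ← gap≡
kohnertMove-cases (suc (suc k)) {D} ad | just c | just r′
  with refl ← trans (sym gap≡) (findGap-below (proj₂ ad) (maxList-rowCols-∈ max≡)) =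
  inj₂ (lowerCell-oneRowDown ad (maxList-rowCols-∈ max≡))

kohnertMove-lowers : ∀ {k c D} → Admissible D → (suc (suc k) , c) ∈ D → OneRowDown D (kohnertMove (suc (suc k)) D)
kohnertMove-lowers {k} {c} {D} ad cell∈D with maxList (rowCols (suc (suc k)) D) in max≡
... | nothing = ⊥-elim (maxList-nothing max≡ (from (∈-rowCols _ c D) cell∈D))
... | just c′ rewrite findGap-below (proj₂ ad) (maxList-rowCols-∈ max≡) =
  lowerCell-oneRowDown ad (maxList-rowCols-∈ max≡)

kohnertMove-rowsum-≤ : ∀ r {D} → Admissible D → rowsum D ≤ suc (rowsum (kohnertMove r D))
kohnertMove-rowsum-≤ r {D} ad with kohnertMove-cases r ad
... | inj₁ fixed = ≤-trans (≤-reflexive (cong rowsum (sym fixed))) (n≤1+n _)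
... | inj₂ down  = ≤-reflexive (OneRowDown.rowsum-suc down)

Reach-trans : ∀ {D E F} → Reach D E → Reach E F → Reach D F
Reach-trans D↠E reach-refl          = D↠E
Reach-trans D↠E (reach-step r E↠F) = reach-step r (Reach-trans D↠E E↠F)

Reach-admissible : ∀ {D E} → Admissible D → Reach D E → Admissible E
Reach-admissible ad reach-refl = ad
Reach-admissible ad (reach-step r D↠E) with kohnertMove-cases r (Reach-admissible ad D↠E)
... | inj₁ fixed = subst Admissible (sym fixed) (Reach-admissible ad D↠E)
... | inj₂ down  = OneRowDown.admissible down

Reach-size : ∀ {D E} → Admissible D → Reach D E → size E ≡ size D
Reach-size ad reach-refl = refl
Reach-size ad (reach-step r D↠E) with kohnertMove-cases r (Reach-admissible ad D↠E)
... | inj₁ fixed = trans (cong size fixed) (Reach-size ad D↠E)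
... | inj₂ down  = trans (OneRowDown.size-≡ down) (Reach-size ad D↠E)

Reach-≡⊎rowsum-< : ∀ {D E} → Admissible D → Reach D E → E ≡ D ⊎ rowsum E < rowsum D
Reach-≡⊎rowsum-< ad reach-refl = inj₁ refl
Reach-≡⊎rowsum-< ad (reach-step r D↠E) with Reach-≡⊎rowsum-< ad D↠E | kohnertMove-cases r (Reach-admissible ad D↠E)
... | inj₁ refl | inj₁ fixed = inj₁ fixed
... | inj₁ refl | inj₂ down  = inj₂ (≤-reflexive (sym (OneRowDown.rowsum-suc down)))
... | inj₂ E<D  | inj₁ fixed = inj₂ (subst (λ F → rowsum F < _) (sym fixed) E<D)
... | inj₂ E<D  | inj₂ down  = inj₂ (<-trans (≤-reflexive (sym (OneRowDown.rowsum-suc down))) E<D)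

-- Rowsum drops by at most one per move, so every intermediate value is attained.
Reach-intermediate : ∀ {D E} → Admissible D → Reach D E → ∀ n → rowsum E ≤ n → n ≤ rowsum D →
  Σ Diagram λ P → Reach D P × Reach P E × rowsum P ≡ n
Reach-intermediate ad reach-refl n E≤n n≤D = _ , reach-refl , reach-refl , ≤-antisym E≤n n≤D
Reach-intermediate ad (reach-step {E = E} r D↠E) n E′≤n n≤D with rowsum (kohnertMove r E) ≟ n
... | yes E′≡n = _ , reach-step r D↠E , reach-refl , E′≡n
... | no E′≢n
  with Reach-intermediate ad D↠E n (≤-trans (kohnertMove-rowsum-≤ r (Reach-admissible ad D↠E)) (≤∧≢⇒< E′≤n E′≢n)) n≤D
...   | P , D↠P , P↠E , P≡n = P , D↠P , reach-step r P↠E , P≡n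

Reach-≐ : ∀ {D D′ E} → D ≐ D′ → Reach D E → Σ Diagram λ E′ → Reach D′ E′ × E ≐ E′
Reach-≐ D≐D′ reach-refl = _ , reach-refl , D≐D′
Reach-≐ D≐D′ (reach-step r D↠E) with Reach-≐ D≐D′ D↠E
... | E′ , D′↠E′ , E≐E′ = kohnertMove r E′ , reach-step r D′↠E′ , kohnertMove-≐ r E≐E′

Grounded : Diagram → Set
Grounded T = ∀ r c → (r , c) ∈ T → r ≡ 1

grounded? : ∀ D → PositiveCells D → Grounded D ⊎ Σ ℕ λ k → Σ ℕ λ c → (suc (suc k) , c) ∈ D
grounded? [] _ = inj₁ λ _ _ ()
grounded? ((zero , c) ∷ D) pos with () ← proj₁ (pos zero c (here refl))
grounded? ((suc (suc k) , c) ∷ D) _ = inj₂ (k , c , here refl)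
grounded? ((suc zero , c) ∷ D) pos with grounded? D (λ r c p → pos r c (there p))
... | inj₁ grounded      = inj₁ λ { _ _ (here refl) → refl ; r c (there p) → grounded r c p }
... | inj₂ (k , c′ , p) = inj₂ (k , c′ , there p)

descend-within : ∀ n {D} → Admissible D → rowsum D < n → Σ Diagram λ T → Reach D T × Grounded T
descend-within (suc n) {D} ad (s≤s D≤n) with grounded? D (proj₁ ad)
... | inj₁ grounded = D , reach-refl , grounded
... | inj₂ (k , c , cell∈D) with kohnertMove-lowers ad cell∈D
...   | down with descend-within n (OneRowDown.admissible down) (≤-trans (≤-reflexive (sym (OneRowDown.rowsum-suc down))) D≤n)
...     | T , E↠T , grounded = T , Reach-trans (reach-step (suc (suc k)) reach-refl) E↠T , grounded

descend : ∀ {D} → Admissible D → Σ Diagram λ T → Reach D T × Grounded T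
descend {D} ad = descend-within (suc (rowsum D)) ad ≤-refl

≼-trans : ∀ {E D F} → E ≼ D → D ≼ F → E ≼ F
≼-trans (E′ , D↠E′ , E′≐E) (D′ , F↠D′ , D′≐D) with Reach-≐ (≐-sym D′≐D) D↠E′
... | E″ , D′↠E″ , E′≐E″ = E″ , Reach-trans F↠D′ D′↠E″ , ≐-trans (≐-sym E′≐E″) E′≐E

≼-admissible : ∀ {D E} → Admissible D → E ≼ D → Admissible E
≼-admissible ad (E′ , D↠E′ , E′≐E) = Admissible-≐ E′≐E (Reach-admissible ad D↠E′)

size≤rowsum : ∀ {D} → PositiveCells D → size D ≤ rowsum D
size≤rowsum {D} pos = cellSum-mono D λ {(r , c)} p → proj₁ (pos r c p)

≼⇒size≤rowsum : ∀ {D E} → Admissible D → E ≼ D → size D ≤ rowsum E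
≼⇒size≤rowsum {D} {E} ad (E′ , D↠E′ , E′≐E) = begin
  size D    ≡⟨ sym (Reach-size ad D↠E′) ⟩
  size E′   ≤⟨ size≤rowsum (proj₁ (Reach-admissible ad D↠E′)) ⟩
  rowsum E′ ≡⟨ cellSum-≐ proj₁ E′≐E ⟩
  rowsum E  ∎
  where open ≤-Reasoning

grounded-rowsum : ∀ {T} → Grounded T → rowsum T ≡ size T
grounded-rowsum {T} grounded = ≤-antisym
  (cellSum-mono T λ {(r , c)} p → ≤-reflexive (grounded r c p))
  (cellSum-mono T λ {(r , c)} p → ≤-reflexive (sym (grounded r c p)))

-- A grounded diagram already has the least rowsum its size allows.
grounded-minimal : ∀ {T E} → Admissible T → Grounded T → E ≼ T → E ≐ T
grounded-minimal {T} ad grounded (E′ , T↠E′ , E′≐E) with Reach-≡⊎rowsum-< ad T↠E′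
... | inj₁ refl = ≐-sym E′≐E
... | inj₂ E′<T = ⊥-elim (≤⇒≯ T≤E′ E′<T)
  where
  open ≤-Reasoning
  T≤E′ : rowsum T ≤ rowsum E′
  T≤E′ = begin
    rowsum T  ≡⟨ grounded-rowsum grounded ⟩
    size T    ≡⟨ sym (Reach-size ad T↠E′) ⟩
    size E′   ≤⟨ size≤rowsum (proj₁ (Reach-admissible ad T↠E′)) ⟩
    rowsum E′ ∎

≼∧rowsum-<⇒≺ : ∀ {D E} → E ≼ D → rowsum E < rowsum D → E ≺ D
≼∧rowsum-<⇒≺ E≼D E<D = E≼D , λ E≐D → <-irrefl (cellSum-≐ proj₁ E≐D) E<D

≺⇒rowsum-< : ∀ {D E} → Admissible D → E ≺ D → rowsum E < rowsum D
≺⇒rowsum-< ad ((E′ , D↠E′ , E′≐E) , E≉D) with Reach-≡⊎rowsum-< ad D↠E′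
... | inj₁ refl = ⊥-elim (E≉D (≐-sym E′≐E))
... | inj₂ E′<D = subst (_< _) (cellSum-≐ proj₁ E′≐E) E′<D

≺-interpolate : ∀ {D E} → Admissible D → E ≺ D → suc (rowsum E) < rowsum D →
  Σ Diagram λ P → P ≼ D × E ≺ P × P ≺ D
≺-interpolate {D} {E} ad ((E′ , D↠E′ , E′≐E) , _) gap
  with Reach-intermediate ad D↠E′ (suc (rowsum E)) (≤-trans (≤-reflexive (cellSum-≐ proj₁ E′≐E)) (n≤1+n _)) (<⇒≤ gap)
... | P , D↠P , P↠E′ , P≡ =
  P , (P , D↠P , ≐-refl) , ≼∧rowsum-<⇒≺ (E′ , P↠E′ , E′≐E) (≤-reflexive (sym P≡))
    , ≼∧rowsum-<⇒≺ (P , D↠P , ≐-refl) (subst (_< rowsum D) (sym P≡) gap)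

covering-rowsum : ∀ {D E} → Admissible D → E ≺ D → (∀ P → P ≼ D → E ≺ P → P ≺ D → ⊥) →
  rowsum D ≡ suc (rowsum E)
covering-rowsum ad E≺D nothing-between with m≤n⇒m<n∨m≡n (≺⇒rowsum-< ad E≺D)
... | inj₂ adjacent = sym adjacent
... | inj₁ gap with ≺-interpolate ad E≺D gap
...   | P , P≼D , E≺P , P≺D = ⊥-elim (nothing-between P P≼D E≺P P≺D)

theorem4p4 : (D0 : Diagram) → PositiveCells D0 → AtMostOnePerColumn D0 →
    Σ ℕ (λ b → IsB D0 b
      × (∀ D → InKD D0 D → b ≤ rowsum D)
      × (∀ D1 D2 → InKD D0 D1 → InKD D0 D2 → D2 ≺ D1 →
           rowsum D2 ∸ b < rowsum D1 ∸ b)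
      × (∀ D1 D2 → InKD D0 D1 → InKD D0 D2 → Covers D0 D1 D2 →
           rowsum D1 ∸ b ≡ suc (rowsum D2 ∸ b)))
theorem4p4 D0 pos opc with descend (pos , opc)
... | T , D0↠T , grounded =
  size D0 , ((T , minimal , rowsumT) , λ T′ → lower T′ ∘ proj₁) , lower , strict , covering
  where
  ad : Admissible D0
  ad = pos , opc
  lower : ∀ D → InKD D0 D → size D0 ≤ rowsum D
  lower D = ≼⇒size≤rowsum ad
  minimal : IsMin D0 T
  minimal = (T , D0↠T , ≐-refl) , λ _ _ → grounded-minimal (Reach-admissible ad D0↠T) grounded
  rowsumT : rowsum T ≡ size D0
  rowsumT = trans (grounded-rowsum grounded) (Reach-size ad D0↠T)
  strict : ∀ D1 D2 → InKD D0 D1 → InKD D0 D2 → D2 ≺ D1 → rowsum D2 ∸ size D0 < rowsum D1 ∸ size D0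
  strict D1 D2 kd1 kd2 D2≺D1 = ∸-monoˡ-< (≺⇒rowsum-< (≼-admissible ad kd1) D2≺D1) (lower D2 kd2)
  covering : ∀ D1 D2 → InKD D0 D1 → InKD D0 D2 → Covers D0 D1 D2 →
    rowsum D1 ∸ size D0 ≡ suc (rowsum D2 ∸ size D0)
  covering D1 D2 kd1 kd2 (D2≺D1 , nothing-between) = begin
    rowsum D1 ∸ size D0       ≡⟨ cong (_∸ size D0) (covering-rowsum (≼-admissible ad kd1) D2≺D1
                                   λ P P≼D1 → nothing-between P (≼-trans P≼D1 kd1)) ⟩
    suc (rowsum D2) ∸ size D0 ≡⟨ +-∸-assoc 1 (lower D2 kd2) ⟩
    suc (rowsum D2 ∸ size D0) ∎
    where open ≡-Reasoning
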